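{- As formal power series in $q$ (equivalently for $|q|<1$), $$1+\sum_{n\ge 1}\mathit{pa}_o(n)q^n=\prod_{k\ge 1}\frac{1+q^k-q^{2k}}{1-q^{2k}}.$$
   Context: A partition of a positive integer $n$ is a weakly decreasing sequence of positive integers with sum $n$. An unlimited parity alternating partition is a partition whose different parts alternate in parity: if the distinct part sizes are $d_1>d_2>\cdots>d_r$, then $d_i$ and $d_{i+1}$ have different parities for every $i$ (parts may be repeated). $\mathit{pa}_o(n)$ is the number of unlimited parity alternating partitions of $n$ whose smallest part is odd. -}

module Defs where

open import Data.Nat as ℕ using (ℕ; zero; suc; _≤_; _<_; _≥_; _∸_; _%_; _*_)
open import Data.Nat.Properties using (_≟_)
open import Data.Nat.Divisibility using (_∣?_)
open import Data.Integer as ℤ using (ℤ; +_; -_)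
open import Data.List using (List; []; _∷_)
open import Data.Nat.ListAction using (sum)
open import Data.List.Relation.Unary.All using (All)
open import Data.List.Relation.Unary.Linked using (Linked)
open import Data.List.Membership.Propositional using (_∈_)
open import Data.Bool using (if_then_else_)
open import Data.Sum using (_⊎_)
open import Data.Product using (_×_; ∃)
open import Relation.Nullary using (does)
open import Relation.Binary.PropositionalEquality using (_≡_; _≢_)

-- Formal power series in q with integer coefficients: n ↦ [q^n]

Series : Set
Series = ℕ → ℤ

sumTo : ℕ → (ℕ → ℤ) → ℤ
sumTo zero    f = f 0
sumTo (suc n) f = sumTo n f ℤ.+ f (suc n)

_⊛_ : Series → Series → Series
(f ⊛ g) n = sumTo n (λ i → f i ℤ.* g (n ∸ i))

_⊕_ : Series → Series → Series
(f ⊕ g) n = f n ℤ.+ g n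

neg : Series → Series
neg f n = - f n

mono : ℕ → Series
mono k n = if does (n ≟ k) then + 1 else + 0

one : Series
one = mono 0

num : ℕ → Series
num k = one ⊕ (mono k ⊕ neg (mono (2 * k)))

-- 1/(1 - q^{2k}) = Σ_{j≥0} q^{2kj}   (used only for k ≥ 1)
geom : ℕ → Series
geom k n = if does (2 * k ∣? n) then + 1 else + 0

factor : ℕ → Series
factor k = num k ⊛ geom k

prodUpTo : ℕ → Series
prodUpTo zero    = one
prodUpTo (suc N) = prodUpTo N ⊛ factor (suc N)

IsPartition : ℕ → List ℕ → Set
IsPartition n p = Linked _≥_ p × All (0 <_) p × sum p ≡ n

-- in a weakly decreasing list, consecutive distinct sizes are adjacent
-- entries that differ; those must have different parity
ParityAlternating : List ℕ → Set
ParityAlternating = Linked (λ a b → a ≡ b ⊎ a % 2 ≢ b % 2)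

SmallestPartOdd : List ℕ → Set
SmallestPartOdd p = ∃ λ m → m ∈ p × m % 2 ≡ 1 × All (m ≤_) p

IsPAo : ℕ → List ℕ → Set
IsPAo n p = IsPartition n p × ParityAlternating p × SmallestPartOdd p

-- Idea. (1 + q^k − q^{2k}) / (1 − q^{2k}) = 1 + Σ_{m odd} q^{km}, so the product of the first N
-- factors counts families of widths m_k ∈ {0} ∪ odd (k ≤ N) by their weight Σ k m_k.  Adding a
-- k × m_k rectangle to the left of the diagram for each k gives the partition with parts
-- μ_i = Σ_{k≥i} m_k; its drops μ_i − μ_{i+1} = m_i are 0 or odd and its last part is odd, so it
-- alternates in parity with odd smallest part, and every such partition with at most N parts
-- arises from exactly one family.
module Submission where

open import Defs
open import Data.Bool using (if_then_else_)
open import Data.Nat as ℕ using (ℕ; zero; suc; _≤_; _≥_; _<_; _∸_; _*_; _%_; _/_; z≤n; s≤s; _≤?_)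
import Data.Nat.Properties as ℕP
open import Data.Nat.DivMod using (m≡m%n+[m/n]*n; [m+kn]%n≡m%n)
open import Data.Nat.Divisibility using (_∣_; _∣?_; divides; ∣-refl; ∣⇒≤; ∣m+n∣m⇒∣n; ∣m∸n∣n⇒∣m; _∣0)
open import Data.Nat.Tactic.RingSolver using (solve-∀)
open import Data.Integer as ℤ using (ℤ; +_; -_; _+_; _-_)
import Data.Integer.Properties as ℤP
open import Algebra.Properties.CommutativeSemigroup ℤP.+-commutativeSemigroup using (interchange)
open import Data.List using (List; []; _∷_; [_]; _++_; length; map; replicate; cartesianProduct; last)
open import Data.Nat.ListAction using (sum)
open import Data.Nat.ListAction.Properties using (sum-++)
open import Data.Maybe using (just)
open import Data.Maybe.Properties using (just-injective)
open import Data.List.Properties using (length-++; length-map; length-replicate; ∷-injective; ∷-injectiveˡ)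
open import Data.List.Relation.Unary.Any using (here; there)
open import Data.List.Membership.Propositional using (_∈_)
open import Data.List.Membership.Propositional.Properties
  using (∈-++⁻; ∈-++⁺ˡ; ∈-++⁺ʳ; ∈-map⁻; ∈-map⁺; ∈-cartesianProduct⁻; ∈-cartesianProduct⁺)
open import Data.List.Relation.Unary.Unique.Propositional using (Unique)
open import Data.List.Relation.Unary.AllPairs using ([]; _∷_)
open import Data.List.Relation.Unary.All as All using (All; []; _∷_)
import Data.List.Relation.Unary.All.Properties as All
open import Data.List.Membership.Propositional.Properties.WithK using (unique∧set⇒bag)
open import Data.List.Relation.Binary.BagAndSetEquality using (∼bag⇒↭)
open import Data.List.Relation.Binary.Permutation.Propositional.Properties using (↭-length)
import Data.List.Relation.Unary.Unique.Propositional.Properties as Unique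
open import Data.Product using (Σ; ∃; _×_; _,_; proj₁; proj₂)
open import Data.Sum using (_⊎_; inj₁; inj₂)
open import Data.Empty using (⊥-elim)
open import Function.Bundles using (_⇔_; mk⇔; Equivalence)
open import Function.Properties.Equivalence using () renaming (trans to Equivalence-trans)
open import Function.Construct.Symmetry using (⇔-sym)
open import Data.List.Relation.Unary.Linked using (Linked; []; [-]; _∷_)
open import Relation.Nullary using (Dec; yes; no; does; ¬_)
open import Relation.Nullary.Decidable using (dec-true; dec-false; does-⇔)
open import Relation.Nullary.Negation using (contradiction)
open import Relation.Binary.Definitions using (tri<; tri≈; tri>)
open import Relation.Binary.PropositionalEquality
  using (_≡_; _≢_; refl; sym; trans; cong; cong₂; subst; module ≡-Reasoning)
open ≡-Reasoning

Odd : ℕ → Set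
Odd n = n % 2 ≡ 1

Admissible : ℕ → Set
Admissible d = d ≡ 0 ⊎ Odd d

parity-cases : ∀ n → n % 2 ≡ 0 ⊎ n % 2 ≡ 1
parity-cases zero          = inj₁ refl
parity-cases (suc zero)    = inj₂ refl
parity-cases (suc (suc n)) = parity-cases n

parity-flip : ∀ y d → ((y ℕ.+ d) % 2 ≢ y % 2) ⇔ Odd d
parity-flip zero d with parity-cases d
... | inj₁ d0 = mk⇔ (λ ne → ⊥-elim (ne d0)) (λ d1 → ⊥-elim (ℕP.0≢1+n (trans (sym d0) d1)))
... | inj₂ d1 = mk⇔ (λ _ → d1) (λ d1 d0 → ℕP.0≢1+n (trans (sym d0) d1))
parity-flip (suc zero) zero          = mk⇔ (λ ne → ⊥-elim (ne refl)) (λ ())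
parity-flip (suc zero) (suc zero)    = mk⇔ (λ _ → refl) (λ _ ())
parity-flip (suc zero) (suc (suc d)) = parity-flip 1 d
parity-flip (suc (suc y)) d          = parity-flip y d

odd-form : ∀ {m} → Odd m → m ≡ suc (m / 2 * 2)
odd-form {m} odd = trans (m≡m%n+[m/n]*n m 2) (cong (ℕ._+ m / 2 * 2) odd)

odd-suc : ∀ q → Odd (suc (q * 2))
odd-suc q = [m+kn]%n≡m%n 1 q 2

sumTo-cong : ∀ n {f g : ℕ → ℤ} → (∀ i → f i ≡ g i) → sumTo n f ≡ sumTo n g
sumTo-cong zero    f≗g = f≗g 0
sumTo-cong (suc n) f≗g = cong₂ _+_ (sumTo-cong n f≗g) (f≗g (suc n))

sumTo-+ : ∀ n (f g : ℕ → ℤ) → sumTo n (λ i → f i + g i) ≡ sumTo n f + sumTo n g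
sumTo-+ zero    f g = refl
sumTo-+ (suc n) f g = trans (cong (_+ (f (suc n) + g (suc n))) (sumTo-+ n f g))
  (interchange (sumTo n f) (sumTo n g) (f (suc n)) (g (suc n)))

sumTo-neg : ∀ n (f : ℕ → ℤ) → sumTo n (λ i → - f i) ≡ - sumTo n f
sumTo-neg zero    f = refl
sumTo-neg (suc n) f = trans (cong (_+ - f (suc n)) (sumTo-neg n f))
  (sym (ℤP.neg-distrib-+ (sumTo n f) (f (suc n))))

⊛-distribʳ-⊕ : ∀ f g h n → ((f ⊕ g) ⊛ h) n ≡ (f ⊛ h) n + (g ⊛ h) n
⊛-distribʳ-⊕ f g h n = trans
  (sumTo-cong n (λ i → ℤP.*-distribʳ-+ (h (n ∸ i)) (f i) (g i))) (sumTo-+ n _ _)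

neg-⊛ : ∀ f g n → (neg f ⊛ g) n ≡ - (f ⊛ g) n
neg-⊛ f g n = trans
  (sumTo-cong n (λ i → sym (ℤP.neg-distribˡ-* (f i) (g (n ∸ i))))) (sumTo-neg n _)

shift : ℕ → Series → Series
shift a g j = if does (a ≤? j) then g (j ∸ a) else + 0

if-yes : ∀ {P : Set} (d : Dec P) {x y : ℤ} → P → (if does d then x else y) ≡ x
if-yes d p rewrite dec-true d p = refl

if-no : ∀ {P : Set} (d : Dec P) {x y : ℤ} → ¬ P → (if does d then x else y) ≡ y
if-no d ¬p rewrite dec-false d ¬p = refl

sumTo-delta : ∀ a j (h : ℕ → ℤ) →
  sumTo j (λ i → mono a i ℤ.* h i) ≡ (if does (a ≤? j) then h a else + 0)
sumTo-delta zero    zero h = ℤP.*-identityˡ (h 0)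
sumTo-delta (suc a) zero h = refl
sumTo-delta a (suc j) h with ℕP.<-cmp a (suc j)
... | tri< a<1+j _ _ = begin
  sumTo j (λ i → mono a i ℤ.* h i) + mono a (suc j) ℤ.* h (suc j)
    ≡⟨ cong₂ _+_ (trans (sumTo-delta a j h) (if-yes (a ≤? j) (ℕP.≤-pred a<1+j)))
                 (cong (ℤ._* h (suc j)) (if-no (suc j ℕP.≟ a) (ℕP.>⇒≢ a<1+j))) ⟩
  h a + + 0  ≡⟨ ℤP.+-identityʳ (h a) ⟩
  h a        ≡⟨ if-yes (a ≤? suc j) (ℕP.<⇒≤ a<1+j) ⟨
  (if does (a ≤? suc j) then h a else + 0) ∎
... | tri≈ _ refl _ = begin
  sumTo j (λ i → mono a i ℤ.* h i) + mono a a ℤ.* h a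
    ≡⟨ cong₂ _+_ (trans (sumTo-delta a j h) (if-no (a ≤? j) (ℕP.<⇒≱ ℕP.≤-refl)))
                 (cong (ℤ._* h a) (if-yes (a ℕP.≟ a) refl)) ⟩
  + 0 + + 1 ℤ.* h a  ≡⟨ trans (ℤP.+-identityˡ _) (ℤP.*-identityˡ (h a)) ⟩
  h a                ≡⟨ if-yes (a ≤? a) ℕP.≤-refl ⟨
  (if does (a ≤? a) then h a else + 0) ∎
... | tri> _ _ a>1+j = begin
  sumTo j (λ i → mono a i ℤ.* h i) + mono a (suc j) ℤ.* h (suc j)
    ≡⟨ cong₂ _+_ (trans (sumTo-delta a j h) (if-no (a ≤? j) (ℕP.<⇒≱ (ℕP.<-trans (ℕP.n<1+n j) a>1+j))))
                 (cong (ℤ._* h (suc j)) (if-no (suc j ℕP.≟ a) (ℕP.<⇒≢ a>1+j))) ⟩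
  + 0  ≡⟨ if-no (a ≤? suc j) (ℕP.<⇒≱ a>1+j) ⟨
  (if does (a ≤? suc j) then h a else + 0) ∎

mono-⊛ : ∀ a g j → (mono a ⊛ g) j ≡ shift a g j
mono-⊛ a g j = sumTo-delta a j (λ i → g (j ∸ i))

-- The k-th factor is 1 + Σ_{m odd} q^{km}: in degree j its coefficient counts the
-- multiplicities m ∈ choices k j, namely m = 0 (if j = 0) and the odd m with k * m ≡ j.
zeroChoice : ℕ → List ℕ
zeroChoice zero    = [ 0 ]
zeroChoice (suc _) = []

oddQuotient : ∀ {k j} → Dec (k ≤ j) → Dec (2 * k ∣ j ∸ k) → List ℕ
oddQuotient (yes _) (yes (divides q _)) = [ suc (q * 2) ]
oddQuotient (yes _) (no _)              = []
oddQuotient (no _)  _                   = []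

oddChoice : ℕ → ℕ → List ℕ
oddChoice k j = oddQuotient (k ≤? j) (2 * k ∣? (j ∸ k))

choices : ℕ → ℕ → List ℕ
choices k j = zeroChoice j ++ oddChoice k j

geom-periodic : ∀ k {j} → 2 * k ≤ j → geom k j ≡ geom k (j ∸ 2 * k)
geom-periodic k {j} 2k≤j = cong (λ b → if b then + 1 else + 0)
  (does-⇔ (mk⇔ lower raise) (2 * k ∣? j) (2 * k ∣? (j ∸ 2 * k)))
  where
  lower : 2 * k ∣ j → 2 * k ∣ j ∸ 2 * k
  lower d = ∣m+n∣m⇒∣n (subst (2 * k ∣_) (sym (ℕP.m+[n∸m]≡n 2k≤j)) d) ∣-refl
  raise : 2 * k ∣ j ∸ 2 * k → 2 * k ∣ j
  raise d = ∣m∸n∣n⇒∣m (2 * k) 2k≤j d ∣-refl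

geom-small : ∀ k j → suc j < 2 * k → geom k (suc j) ≡ + 0
geom-small k j lt = if-no (2 * k ∣? suc j) (λ d → ℕP.<⇒≱ lt (∣⇒≤ d))

-- (1 − q^{2k}) · geom k = 1, i.e. geom k really is 1 / (1 − q^{2k}).
geom-inverse : ∀ {k} → 1 ≤ k → ∀ j → geom k j - shift (2 * k) (geom k) j ≡ + length (zeroChoice j)
geom-inverse {k} 1≤k zero = cong₂ _-_ (if-yes (2 * k ∣? 0) ((2 * k) ∣0))
  (if-no (2 * k ≤? 0) (ℕP.<⇒≱ (ℕP.≤-trans 1≤k (ℕP.m≤m+n k _))))
geom-inverse {k} 1≤k (suc j) with 2 * k ≤? suc j
... | yes 2k≤1+j = begin
  geom k (suc j) - shift (2 * k) (geom k) (suc j)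
    ≡⟨ cong₂ _-_ (geom-periodic k 2k≤1+j) (if-yes (2 * k ≤? suc j) 2k≤1+j) ⟩
  geom k (suc j ∸ 2 * k) - geom k (suc j ∸ 2 * k)  ≡⟨ ℤP.+-inverseʳ (geom k (suc j ∸ 2 * k)) ⟩
  + 0 ∎
... | no 2k≰1+j = cong₂ _-_ (geom-small k j (ℕP.≰⇒> 2k≰1+j)) (if-no (2 * k ≤? suc j) 2k≰1+j)

shift-geom : ∀ k j → shift k (geom k) j ≡ + length (oddChoice k j)
shift-geom k j = by-decisions (k ≤? j) (2 * k ∣? (j ∸ k))
  where
  by-decisions : (k≤?j : Dec (k ≤ j)) (2k∣?j∸k : Dec (2 * k ∣ j ∸ k)) →
    (if does k≤?j then (if does 2k∣?j∸k then + 1 else + 0) else + 0)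
      ≡ + length (oddQuotient k≤?j 2k∣?j∸k)
  by-decisions (yes _) (yes (divides _ _)) = refl
  by-decisions (yes _) (no _)              = refl
  by-decisions (no _)  _                   = refl

-- Hence factor k = geom k − q^{2k} geom k + q^k geom k = 1 + Σ_{m odd} q^{km}.
factor-coefficient : ∀ {k} → 1 ≤ k → ∀ j → factor k j ≡ + length (choices k j)
factor-coefficient {k} 1≤k j = begin
  factor k j
    ≡⟨ ⊛-distribʳ-⊕ one _ (geom k) j ⟩
  (one ⊛ g) j + ((mono k ⊕ neg (mono (2 * k))) ⊛ g) j
    ≡⟨ cong (λ x → (one ⊛ g) j + x) (trans (⊛-distribʳ-⊕ (mono k) _ g j)
                                           (cong (λ x → (mono k ⊛ g) j + x) (neg-⊛ (mono (2 * k)) g j))) ⟩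
  (one ⊛ g) j + ((mono k ⊛ g) j - (mono (2 * k) ⊛ g) j)
    ≡⟨ cong₂ (λ x y → x + (y - (mono (2 * k) ⊛ g) j)) (mono-⊛ 0 g j) (mono-⊛ k g j) ⟩
  g j + (shift k g j - (mono (2 * k) ⊛ g) j)
    ≡⟨ cong (λ z → g j + (shift k g j - z)) (mono-⊛ (2 * k) g j) ⟩
  g j + (shift k g j - shift (2 * k) g j)
    ≡⟨ regroup (g j) (shift k g j) (shift (2 * k) g j) ⟩
  (g j - shift (2 * k) g j) + shift k g j
    ≡⟨ cong₂ _+_ (geom-inverse 1≤k j) (shift-geom k j) ⟩
  + length (zeroChoice j) + + length (oddChoice k j)
    ≡⟨ ℤP.pos-+ (length (zeroChoice j)) _ ⟨
  + (length (zeroChoice j) ℕ.+ length (oddChoice k j))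
    ≡⟨ cong +_ (length-++ (zeroChoice j)) ⟨
  + length (choices k j) ∎
  where
  g : Series
  g = geom k
  regroup : ∀ a b c → a + (b - c) ≡ (a - c) + b
  regroup a b c = trans (cong (λ x → a + x) (ℤP.+-comm b (- c))) (sym (ℤP.+-assoc a (- c) b))

odd-multiple : ∀ k q → k * suc (q * 2) ≡ k ℕ.+ q * (2 * k)
odd-multiple = solve-∀

∈-oddQuotient⁻ : ∀ {k j m} (k≤?j : Dec (k ≤ j)) (2k∣?j∸k : Dec (2 * k ∣ j ∸ k)) →
  m ∈ oddQuotient k≤?j 2k∣?j∸k → Odd m × k * m ≡ j
∈-oddQuotient⁻ {k} {j} (yes k≤j) (yes (divides q j∸k≡q*2k)) (here refl) = odd-suc q , (begin
  k * suc (q * 2)      ≡⟨ odd-multiple k q ⟩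
  k ℕ.+ q * (2 * k)    ≡⟨ cong (k ℕ.+_) j∸k≡q*2k ⟨
  k ℕ.+ (j ∸ k)        ≡⟨ ℕP.m+[n∸m]≡n k≤j ⟩
  j ∎)

∈-oddQuotient⁺ : ∀ {k j m} → 1 ≤ k → Odd m → k * m ≡ j →
  (k≤?j : Dec (k ≤ j)) (2k∣?j∸k : Dec (2 * k ∣ j ∸ k)) → m ∈ oddQuotient k≤?j 2k∣?j∸k
∈-oddQuotient⁺ {k} {j} {m} 1≤k odd km≡j = by-decisions
  where
  h = m / 2
  j≡k+h*2k : j ≡ k ℕ.+ h * (2 * k)
  j≡k+h*2k = trans (sym km≡j) (trans (cong (k *_) (odd-form odd)) (odd-multiple k h))
  k≤j : k ≤ j
  k≤j = subst (k ≤_) (sym j≡k+h*2k) (ℕP.m≤m+n k _)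
  2k∣j∸k : 2 * k ∣ j ∸ k
  2k∣j∸k = divides h (trans (cong (_∸ k) j≡k+h*2k) (ℕP.m+n∸m≡n k _))
  by-decisions : (k≤?j : Dec (k ≤ j)) (2k∣?j∸k : Dec (2 * k ∣ j ∸ k)) → m ∈ oddQuotient k≤?j 2k∣?j∸k
  by-decisions (yes k≤j) (yes (divides q eq)) = here (ℕP.*-cancelˡ-≡ m _ k {{ℕ.>-nonZero 1≤k}}
    (trans km≡j (sym (proj₂ (∈-oddQuotient⁻ (yes k≤j) (yes (divides q eq)) (here refl))))))
  by-decisions (yes _)   (no 2k∤j∸k) = contradiction 2k∣j∸k 2k∤j∸k
  by-decisions (no k≰j)  _           = contradiction k≤j k≰j

∈-choices⁻ : ∀ k j {m} → m ∈ choices k j → Admissible m × k * m ≡ j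
∈-choices⁻ k j m∈ with ∈-++⁻ (zeroChoice j) m∈
∈-choices⁻ k zero m∈ | inj₁ (here refl) = inj₁ refl , ℕP.*-zeroʳ k
∈-choices⁻ k j    m∈ | inj₂ m∈odd with ∈-oddQuotient⁻ (k ≤? j) (2 * k ∣? (j ∸ k)) m∈odd
... | odd , km≡j = inj₂ odd , km≡j

∈-choices⁺ : ∀ {k j m} → 1 ≤ k → Admissible m → k * m ≡ j → m ∈ choices k j
∈-choices⁺ {k} 1≤k (inj₁ refl) k0≡j =
  subst (λ j → 0 ∈ choices k j) (trans (sym (ℕP.*-zeroʳ k)) k0≡j) (here refl)
∈-choices⁺ {k} {j} 1≤k (inj₂ odd)  km≡j =
  ∈-++⁺ʳ (zeroChoice j) (∈-oddQuotient⁺ 1≤k odd km≡j (k ≤? j) (2 * k ∣? (j ∸ k)))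

choices-unique : ∀ k j → Unique (choices k j)
choices-unique k j = Unique.++⁺ (zero-unique j) (odd-unique (k ≤? j) (2 * k ∣? (j ∸ k))) disjoint
  where
  zero-unique : ∀ j → Unique (zeroChoice j)
  zero-unique zero    = [] ∷ []
  zero-unique (suc _) = []
  odd-unique : (k≤?j : Dec (k ≤ j)) (2k∣?j∸k : Dec (2 * k ∣ j ∸ k)) → Unique (oddQuotient k≤?j 2k∣?j∸k)
  odd-unique (yes _) (yes (divides _ _)) = [] ∷ []
  odd-unique (yes _) (no _)              = []
  odd-unique (no _)  _                   = []
  disjoint : ∀ {m} → ¬ (m ∈ zeroChoice j × m ∈ oddChoice k j)
  disjoint (m∈zero , m∈odd) = zero-not-odd j m∈zero m∈odd
    where
    zero-not-odd : ∀ j {m} → m ∈ zeroChoice j → ¬ m ∈ oddChoice k j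
    zero-not-odd zero (here refl) m∈odd
      with () ← proj₁ (∈-oddQuotient⁻ (k ≤? 0) (2 * k ∣? (0 ∸ k)) m∈odd)

concatTo : ∀ {A : Set} → ℕ → (ℕ → List A) → List A
concatTo zero    f = f 0
concatTo (suc n) f = concatTo n f ++ f (suc n)

length-concatTo : ∀ {A : Set} n (f : ℕ → List A) →
  sumTo n (λ i → + length (f i)) ≡ + length (concatTo n f)
length-concatTo zero    f = refl
length-concatTo (suc n) f = begin
  sumTo n (λ i → + length (f i)) + + length (f (suc n))
    ≡⟨ cong (_+ + length (f (suc n))) (length-concatTo n f) ⟩
  + length (concatTo n f) + + length (f (suc n))
    ≡⟨ ℤP.pos-+ (length (concatTo n f)) _ ⟨
  + (length (concatTo n f) ℕ.+ length (f (suc n)))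
    ≡⟨ cong +_ (length-++ (concatTo n f)) ⟨
  + length (concatTo n f ++ f (suc n)) ∎

∈-concatTo⁻ : ∀ {A : Set} {x : A} n f → x ∈ concatTo n f → ∃ λ i → i ≤ n × x ∈ f i
∈-concatTo⁻ zero    f x∈ = 0 , z≤n , x∈
∈-concatTo⁻ (suc n) f x∈ with ∈-++⁻ (concatTo n f) x∈
... | inj₂ x∈last = suc n , ℕP.≤-refl , x∈last
... | inj₁ x∈init with ∈-concatTo⁻ n f x∈init
...   | i , i≤n , x∈fi = i , ℕP.m≤n⇒m≤1+n i≤n , x∈fi

∈-concatTo⁺ : ∀ {A : Set} {x : A} {i} n f → i ≤ n → x ∈ f i → x ∈ concatTo n f
∈-concatTo⁺ zero    f z≤n x∈ = x∈
∈-concatTo⁺ (suc n) f i≤1+n x∈ with ℕP.m≤n⇒m<n∨m≡n i≤1+n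
... | inj₁ i<1+n = ∈-++⁺ˡ (∈-concatTo⁺ n f (ℕP.≤-pred i<1+n) x∈)
... | inj₂ refl  = ∈-++⁺ʳ (concatTo n f) x∈

concatTo-unique : ∀ {A : Set} n (f : ℕ → List A) → (∀ i → Unique (f i)) →
  (∀ {i j x} → x ∈ f i → x ∈ f j → i ≡ j) → Unique (concatTo n f)
concatTo-unique zero    f unique disjoint = unique 0
concatTo-unique (suc n) f unique disjoint =
  Unique.++⁺ (concatTo-unique n f unique disjoint) (unique (suc n)) λ (x∈init , x∈last) →
    let (i , i≤n , x∈fi) = ∈-concatTo⁻ n f x∈init
    in ℕP.<⇒≢ (s≤s i≤n) (disjoint x∈fi x∈last)

length-cartesianProduct : ∀ {A B : Set} (xs : List A) (ys : List B) →
  length (cartesianProduct xs ys) ≡ length xs * length ys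
length-cartesianProduct []       ys = refl
length-cartesianProduct (x ∷ xs) ys = begin
  length (map (x ,_) ys ++ cartesianProduct xs ys)
    ≡⟨ length-++ (map (x ,_) ys) ⟩
  length (map (x ,_) ys) ℕ.+ length (cartesianProduct xs ys)
    ≡⟨ cong₂ ℕ._+_ (length-map (x ,_) ys) (length-cartesianProduct xs ys) ⟩
  length ys ℕ.+ length xs * length ys ∎

map-unique : ∀ {A B : Set} (f : A → B) {xs} →
  (∀ {x y} → x ∈ xs → y ∈ xs → f x ≡ f y → x ≡ y) → Unique xs → Unique (map f xs)
map-unique f injective []           = []
map-unique f injective (x∉xs ∷ xs!) =
  All.map⁺ (All.tabulate λ y∈xs fx≡fy →
    All.lookup x∉xs y∈xs (injective (here refl) (there y∈xs) fx≡fy))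
  ∷ map-unique f (λ x∈ y∈ → injective (there x∈) (there y∈)) xs!

length-unique : ∀ {A : Set} {xs ys : List A} → Unique xs → Unique ys →
  (∀ {x} → x ∈ xs ⇔ x ∈ ys) → length xs ≡ length ys
length-unique xs! ys! same = ↭-length (∼bag⇒↭ (unique∧set⇒bag xs! ys! same))

-- Alternating 0 is the shape
-- counted by pa_o; the base b is needed because adding a rectangle shifts the parts.
data Alternating (b : ℕ) : List ℕ → Set where
  nil  : Alternating b []
  end  : ∀ {x} → b ≤ x → Odd (x ∸ b) → Alternating b [ x ]
  cons : ∀ {x y r} → y ≤ x → Admissible (x ∸ y) → Alternating b (y ∷ r) → Alternating b (x ∷ y ∷ r)

alternating-above : ∀ {b μ} → Alternating b μ → All (b <_) μ
alternating-above nil = []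
alternating-above {b} (end {x} b≤x odd) = ℕP.≤∧≢⇒< b≤x b≢x ∷ []
  where
  b≢x : b ≢ x
  b≢x refl with () ← trans (cong (_% 2) (sym (ℕP.n∸n≡0 b))) odd
alternating-above (cons y≤x _ rest) with alternating-above rest
... | b<y ∷ b<r = ℕP.<-≤-trans b<y y≤x ∷ b<y ∷ b<r

alternating-shift : ∀ {b} m {ν} → Alternating b ν → Alternating (m ℕ.+ b) (map (m ℕ.+_) ν)
alternating-shift m nil = nil
alternating-shift {b} m (end {x} b≤x odd) =
  end (ℕP.+-monoʳ-≤ m b≤x) (subst Odd (sym (ℕP.[m+n]∸[m+o]≡n∸o m x b)) odd)
alternating-shift m (cons {x} {y} y≤x adm rest) =
  cons (ℕP.+-monoʳ-≤ m y≤x) (subst Admissible (sym (ℕP.[m+n]∸[m+o]≡n∸o m x y)) adm)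
       (alternating-shift m rest)

alternating-pad : ∀ {m} p {ν} → Odd m → Alternating m ν → Alternating 0 (ν ++ replicate (suc p) m)
alternating-pad {m} p odd nil = copies p
  where
  copies : ∀ p → Alternating 0 (replicate (suc p) m)
  copies zero    = end z≤n odd
  copies (suc p) = cons ℕP.≤-refl (inj₁ (ℕP.n∸n≡0 m)) (copies p)
alternating-pad p odd (end m≤x odd-drop) = cons m≤x (inj₂ odd-drop) (alternating-pad p odd nil)
alternating-pad p odd (cons y≤x adm rest) = cons y≤x adm (alternating-pad p odd rest)

record Peeled (μ : List ℕ) : Set where
  constructor peeled
  field
    width            : ℕ
    rest             : List ℕ
    extra            : ℕ
    shape            : μ ≡ map (width ℕ.+_) rest ++ replicate (suc extra) width
    rest-alternating : Alternating 0 rest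
    odd-width        : Odd width

peel : ∀ {x r} → Alternating 0 (x ∷ r) → Peeled (x ∷ r)
peel (end _ odd) = peeled _ [] 0 refl nil odd
peel {x = x} (cons y≤x adm rest) with peel rest
... | peeled m [] p refl _ odd with adm
...   | inj₁ x∸m≡0 = peeled m [] (suc p)
          (cong (λ z → z ∷ m ∷ replicate p m) (ℕP.≤-antisym (ℕP.m∸n≡0⇒m≤n x∸m≡0) y≤x)) nil odd
...   | inj₂ odd-drop = peeled m [ x ∸ m ] p
          (cong (λ z → z ∷ m ∷ replicate p m) (sym (ℕP.m+[n∸m]≡n y≤x))) (end z≤n odd-drop) odd
peel {x = x} (cons y≤x adm rest) | peeled m (v ∷ vs) p refl ν-alternating odd =
  peeled m ((x ∸ m) ∷ v ∷ vs) p (cong (λ z → z ∷ _) (sym (ℕP.m+[n∸m]≡n m≤x)))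
    (cons v≤x∸m (subst Admissible (sym (ℕP.∸-+-assoc x m v)) adm) ν-alternating) odd
  where
  m≤x : m ≤ x
  m≤x = ℕP.≤-trans (ℕP.m≤m+n m v) y≤x
  v≤x∸m : v ≤ x ∸ m
  v≤x∸m = subst (_≤ x ∸ m) (ℕP.m+n∸m≡n m v) (ℕP.∸-monoˡ-≤ m y≤x)

-- rect k m ν adds a k × m rectangle to the left of the diagram of ν (length ν ≤ k):
-- every part of ν is raised by m and parts equal to m are appended up to k parts.
rect : ℕ → ℕ → List ℕ → List ℕ
rect k m ν = map (m ℕ.+_) ν ++ replicate (k ∸ length ν) m

addRect : ℕ → ℕ → List ℕ → List ℕ
addRect k zero    ν = ν
addRect k (suc m) ν = rect k (suc m) ν

addRect-odd : ∀ k {m} ν → Odd m → addRect k m ν ≡ rect k m ν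
addRect-odd k {suc m} ν _ = refl

-- A rectangle of height N + 1 added to at most N parts always creates at least one new part.
padding : ∀ N (ν : List ℕ) → length ν ≤ N → suc N ∸ length ν ≡ suc (N ∸ length ν)
padding N ν ν≤N = ℕP.+-∸-assoc 1 ν≤N

length-rect : ∀ k m ν → length ν ≤ k → length (rect k m ν) ≡ k
length-rect k m ν ν≤k = begin
  length (map (m ℕ.+_) ν ++ replicate (k ∸ length ν) m)
    ≡⟨ length-++ (map (m ℕ.+_) ν) ⟩
  length (map (m ℕ.+_) ν) ℕ.+ length (replicate (k ∸ length ν) m)
    ≡⟨ cong₂ ℕ._+_ (length-map (m ℕ.+_) ν) (length-replicate (k ∸ length ν)) ⟩
  length ν ℕ.+ (k ∸ length ν)
    ≡⟨ ℕP.m+[n∸m]≡n ν≤k ⟩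
  k ∎

sum-raise : ∀ m ν → sum (map (m ℕ.+_) ν) ≡ length ν * m ℕ.+ sum ν
sum-raise m []      = refl
sum-raise m (x ∷ ν) = trans (cong (m ℕ.+ x ℕ.+_) (sum-raise m ν)) (regroup m x (length ν * m) (sum ν))
  where
  regroup : ∀ m x a s → m ℕ.+ x ℕ.+ (a ℕ.+ s) ≡ m ℕ.+ a ℕ.+ (x ℕ.+ s)
  regroup = solve-∀

sum-replicate : ∀ r m → sum (replicate r m) ≡ r * m
sum-replicate zero    m = refl
sum-replicate (suc r) m = cong (m ℕ.+_) (sum-replicate r m)

sum-rect : ∀ k m ν → length ν ≤ k → sum (rect k m ν) ≡ k * m ℕ.+ sum ν
sum-rect k m ν ν≤k = begin
  sum (map (m ℕ.+_) ν ++ replicate (k ∸ length ν) m)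
    ≡⟨ sum-++ (map (m ℕ.+_) ν) _ ⟩
  sum (map (m ℕ.+_) ν) ℕ.+ sum (replicate (k ∸ length ν) m)
    ≡⟨ cong₂ ℕ._+_ (sum-raise m ν) (sum-replicate (k ∸ length ν) m) ⟩
  length ν * m ℕ.+ sum ν ℕ.+ (k ∸ length ν) * m
    ≡⟨ regroup (length ν) (k ∸ length ν) m (sum ν) ⟩
  (length ν ℕ.+ (k ∸ length ν)) * m ℕ.+ sum ν
    ≡⟨ cong (λ k → k * m ℕ.+ sum ν) (ℕP.m+[n∸m]≡n ν≤k) ⟩
  k * m ℕ.+ sum ν ∎
  where
  regroup : ∀ l r m s → l * m ℕ.+ s ℕ.+ r * m ≡ (l ℕ.+ r) * m ℕ.+ s
  regroup = solve-∀

rect-alternating : ∀ {N m ν} → Odd m → length ν ≤ N → Alternating 0 ν → Alternating 0 (rect (suc N) m ν)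
rect-alternating {N} {m} {ν} odd ν≤N ν-alternating =
  subst (λ r → Alternating 0 (map (m ℕ.+_) ν ++ replicate r m)) (sym (padding N ν ν≤N))
    (alternating-pad (N ∸ length ν) odd
      (subst (λ b → Alternating b (map (m ℕ.+_) ν)) (ℕP.+-identityʳ m) (alternating-shift m ν-alternating)))

last-rect : ∀ {N} m ν → length ν ≤ N → last (rect (suc N) m ν) ≡ just m
last-rect {N} m ν ν≤N = subst (λ r → last (map (m ℕ.+_) ν ++ replicate r m) ≡ just m)
  (sym (padding N ν ν≤N)) (last-padded (map (m ℕ.+_) ν) _)
  where
  last-padded : ∀ xs p → last (xs ++ replicate (suc p) m) ≡ just m
  last-padded []           zero    = refl
  last-padded []           (suc p) = last-padded [] p
  last-padded (x ∷ [])     p       = last-padded [] p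
  last-padded (x ∷ y ∷ xs) p       = last-padded (y ∷ xs) p

-- Positive parts raised by m stay above the padding m, so the raised list determines ν.
rect-cancel : ∀ m {r r'} ν ν' → All (0 <_) ν → All (0 <_) ν' →
  map (m ℕ.+_) ν ++ replicate r m ≡ map (m ℕ.+_) ν' ++ replicate r' m → ν ≡ ν'
rect-cancel m []      []       _           _            _  = refl
rect-cancel m {zero}  []       (y ∷ ν')    _            _         ()
rect-cancel m {suc r} []       (y ∷ ν')    _            (0<y ∷ _) eq =
  contradiction (∷-injectiveˡ eq) (ℕP.<⇒≢ (ℕP.m<m+n m 0<y))
rect-cancel m {r' = zero}   (x ∷ ν) [] _ _ ()
rect-cancel m {r' = suc r'} (x ∷ ν) [] (0<x ∷ _) _ eq =
  contradiction (sym (∷-injectiveˡ eq)) (ℕP.<⇒≢ (ℕP.m<m+n m 0<x))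
rect-cancel m (x ∷ ν) (y ∷ ν') (_ ∷ ν>0) (_ ∷ ν'>0) eq with ∷-injective eq
... | m+x≡m+y , rest≡ = cong₂ _∷_ (ℕP.+-cancelˡ-≡ m x y m+x≡m+y) (rect-cancel m ν ν' ν>0 ν'>0 rest≡)

AltPart : ℕ → List ℕ → Set
AltPart N ν = Alternating 0 ν × length ν ≤ N

sum-addRect : ∀ k m ν → length ν ≤ k → sum (addRect k m ν) ≡ k * m ℕ.+ sum ν
sum-addRect k zero    ν _   = cong (ℕ._+ sum ν) (sym (ℕP.*-zeroʳ k))
sum-addRect k (suc m) ν ν≤k = sum-rect k (suc m) ν ν≤k

addRect-altPart : ∀ {N m ν} → Admissible m → AltPart N ν → AltPart (suc N) (addRect (suc N) m ν)
addRect-altPart (inj₁ refl) (ν-alternating , ν≤N) = ν-alternating , ℕP.m≤n⇒m≤1+n ν≤N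
addRect-altPart {N} {m} {ν} (inj₂ odd) (ν-alternating , ν≤N) =
  subst (AltPart (suc N)) (sym (addRect-odd (suc N) ν odd))
    (rect-alternating odd ν≤N ν-alternating , ℕP.≤-reflexive (length-rect (suc N) m ν (ℕP.m≤n⇒m≤1+n ν≤N)))

-- A genuine rectangle of height N + 1 makes N + 1 parts, one more than ν can have.
addRect-too-long : ∀ {N m ν ν'} → Odd m → length ν ≤ N → length ν' ≤ N → ν ≢ addRect (suc N) m ν'
addRect-too-long {N} {m} {ν} {ν'} odd ν≤N ν'≤N ν≡ = ℕP.n≮n N (subst (_≤ N) length-ν ν≤N)
  where
  length-ν : length ν ≡ suc N
  length-ν = trans (cong length (trans ν≡ (addRect-odd (suc N) ν' odd)))
                   (length-rect (suc N) m ν' (ℕP.m≤n⇒m≤1+n ν'≤N))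

-- Adding a rectangle of height N + 1 is injective on alternating partitions with at most
-- N parts: the width of a genuine rectangle is the last part, and the rest cancels.
addRect-injective : ∀ {N m m' ν ν'} → Admissible m → Admissible m' → AltPart N ν → AltPart N ν' →
  addRect (suc N) m ν ≡ addRect (suc N) m' ν' → m ≡ m' × ν ≡ ν'
addRect-injective (inj₁ refl) (inj₁ refl) _ _ ν≡ν' = refl , ν≡ν'
addRect-injective {N} {m' = m'} {ν} {ν'} (inj₁ refl) (inj₂ odd') (_ , ν≤N) (_ , ν'≤N) eq =
  contradiction eq (addRect-too-long {N} {m'} {ν} {ν'} odd' ν≤N ν'≤N)
addRect-injective {N} {m} {ν = ν} {ν'} (inj₂ odd) (inj₁ refl) (_ , ν≤N) (_ , ν'≤N) eq =
  contradiction (sym eq) (addRect-too-long {N} {m} {ν'} {ν} odd ν'≤N ν≤N)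
addRect-injective {N} {m} {m'} {ν} {ν'} (inj₂ odd) (inj₂ odd') (ν-alt , ν≤N) (ν'-alt , ν'≤N) eq =
  m≡m' , rect-cancel m ν ν' (alternating-above ν-alt) (alternating-above ν'-alt)
           (trans rect≡ (cong (λ w → rect (suc N) w ν') (sym m≡m')))
  where
  rect≡ : rect (suc N) m ν ≡ rect (suc N) m' ν'
  rect≡ = trans (sym (addRect-odd (suc N) ν odd)) (trans eq (addRect-odd (suc N) ν' odd'))
  m≡m' : m ≡ m'
  m≡m' = just-injective
    (trans (sym (last-rect m ν ν≤N)) (trans (cong last rect≡) (last-rect m' ν' ν'≤N)))

-- Conversely, every alternating partition with at most N + 1 parts arises this way: one
-- with exactly N + 1 parts is a rectangle whose width is its (odd) last part, added to
-- the partition that remains.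
addRect-surjective : ∀ {N μ} → AltPart (suc N) μ →
  ∃ λ m → ∃ λ ν → Admissible m × AltPart N ν × μ ≡ addRect (suc N) m ν
addRect-surjective {N} {μ} (μ-alt , μ≤1+N) with length μ ≤? N
... | yes μ≤N = 0 , μ , inj₁ refl , (μ-alt , μ≤N) , refl
addRect-surjective {N} {[]}    _               | no μ≰N = contradiction z≤n μ≰N
addRect-surjective {N} {x ∷ r} (μ-alt , μ≤1+N) | no μ≰N =
  m , ν , inj₂ odd-width , (rest-alternating , ν≤N) , μ≡rect
  where
  open Peeled (peel μ-alt) renaming (width to m; rest to ν; extra to p)
  length-μ : length (x ∷ r) ≡ length ν ℕ.+ suc p
  length-μ = trans (cong length shape) (trans (length-++ (map (m ℕ.+_) ν))
    (cong₂ ℕ._+_ (length-map (m ℕ.+_) ν) (length-replicate (suc p))))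
  ν+p≡N : length ν ℕ.+ suc p ≡ suc N
  ν+p≡N = trans (sym length-μ) (ℕP.≤-antisym μ≤1+N (ℕP.≰⇒> μ≰N))
  ν≤N : length ν ≤ N
  ν≤N = ℕP.≤-pred (subst (length ν <_) ν+p≡N (ℕP.m<m+n (length ν) (s≤s z≤n)))
  μ≡rect : x ∷ r ≡ addRect (suc N) m ν
  μ≡rect = begin
    x ∷ r                                      ≡⟨ shape ⟩
    map (m ℕ.+_) ν ++ replicate (suc p) m      ≡⟨ cong (λ k → map (m ℕ.+_) ν ++ replicate k m)
                                                       (ℕP.m+n∸m≡n (length ν) (suc p)) ⟨
    map (m ℕ.+_) ν ++ replicate (length ν ℕ.+ suc p ∸ length ν) m
      ≡⟨ cong (λ k → map (m ℕ.+_) ν ++ replicate (k ∸ length ν) m) ν+p≡N ⟩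
    rect (suc N) m ν                           ≡⟨ addRect-odd (suc N) ν odd-width ⟨
    addRect (suc N) m ν ∎

-- The pairs (ν, m) with ν ∈ g i and m ∈ choices k (n ∸ i), over i = 0, …, n: the list
-- counterpart of the coefficient of q^n in a product whose last factor is factor k.
graded : (ℕ → List (List ℕ)) → ℕ → ℕ → List (List ℕ × ℕ)
graded g k n = concatTo n (λ i → cartesianProduct (g i) (choices k (n ∸ i)))

∈-graded⁻ : ∀ g k n {ν m} → (ν , m) ∈ graded g k n →
  ∃ λ i → i ≤ n × ν ∈ g i × m ∈ choices k (n ∸ i)
∈-graded⁻ g k n pair∈ with ∈-concatTo⁻ n _ pair∈
... | i , i≤n , pair∈block with ∈-cartesianProduct⁻ (g i) (choices k (n ∸ i)) pair∈block
...   | ν∈ , m∈ = i , i≤n , ν∈ , m∈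

∈-graded⁺ : ∀ g k n {ν m i} → i ≤ n → ν ∈ g i → m ∈ choices k (n ∸ i) → (ν , m) ∈ graded g k n
∈-graded⁺ g k n i≤n ν∈ m∈ = ∈-concatTo⁺ n _ i≤n (∈-cartesianProduct⁺ ν∈ m∈)

graft : ℕ → List ℕ × ℕ → List ℕ
graft k (ν , m) = addRect k m ν

-- altParts N n lists the alternating partitions of n with at most N parts, generated like
-- prodUpTo N: the k-th factor adds a rectangle of height k and admissible width.
altParts : ℕ → ℕ → List (List ℕ)
altParts zero    zero    = [ [] ]
altParts zero    (suc _) = []
altParts (suc N) n       = map (graft (suc N)) (graded (altParts N) (suc N) n)

prodUpTo-counts : ∀ N n → prodUpTo N n ≡ + length (altParts N n)
prodUpTo-counts zero    zero    = refl
prodUpTo-counts zero    (suc n) = refl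
prodUpTo-counts (suc N) n = begin
  sumTo n (λ i → prodUpTo N i ℤ.* factor (suc N) (n ∸ i))
    ≡⟨ sumTo-cong n (λ i → cong₂ ℤ._*_ (prodUpTo-counts N i) (factor-coefficient (s≤s z≤n) (n ∸ i))) ⟩
  sumTo n (λ i → + length (altParts N i) ℤ.* + length (choices (suc N) (n ∸ i)))
    ≡⟨ sumTo-cong n (λ i → trans (sym (ℤP.pos-* (length (altParts N i)) _))
                                 (cong +_ (sym (length-cartesianProduct (altParts N i) _)))) ⟩
  sumTo n (λ i → + length (cartesianProduct (altParts N i) (choices (suc N) (n ∸ i))))
    ≡⟨ length-concatTo n _ ⟩
  + length (graded (altParts N) (suc N) n)
    ≡⟨ cong +_ (length-map (graft (suc N)) (graded (altParts N) (suc N) n)) ⟨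
  + length (altParts (suc N) n) ∎

altParts-sound : ∀ N n {μ} → μ ∈ altParts N n → AltPart N μ × sum μ ≡ n
altParts-sound zero    zero (here refl) = (nil , z≤n) , refl
altParts-sound (suc N) n μ∈ with ∈-map⁻ (graft (suc N)) μ∈
... | (ν , m) , pair∈ , refl with ∈-graded⁻ (altParts N) (suc N) n pair∈
...   | i , i≤n , ν∈ , m∈ with altParts-sound N i ν∈ | ∈-choices⁻ (suc N) (n ∸ i) m∈
...     | ν-part , refl | admissible , km≡n∸i = addRect-altPart admissible ν-part , (begin
  sum (addRect (suc N) m ν)  ≡⟨ sum-addRect (suc N) m ν (ℕP.m≤n⇒m≤1+n (proj₂ ν-part)) ⟩
  suc N * m ℕ.+ sum ν         ≡⟨ cong (ℕ._+ sum ν) km≡n∸i ⟩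
  n ∸ sum ν ℕ.+ sum ν         ≡⟨ ℕP.m∸n+n≡m i≤n ⟩
  n ∎)

altParts-complete : ∀ N {μ} → AltPart N μ → μ ∈ altParts N (sum μ)
altParts-complete zero    {[]} _ = here refl
altParts-complete (suc N) μ-part with addRect-surjective μ-part
... | m , ν , admissible , ν-part , refl =
  ∈-map⁺ (graft (suc N)) (∈-graded⁺ (altParts N) (suc N) _ sum-ν≤ (altParts-complete N ν-part) m∈)
  where
  sum-μ : sum (addRect (suc N) m ν) ≡ suc N * m ℕ.+ sum ν
  sum-μ = sum-addRect (suc N) m ν (ℕP.m≤n⇒m≤1+n (proj₂ ν-part))
  sum-ν≤ : sum ν ≤ sum (addRect (suc N) m ν)
  sum-ν≤ = subst (sum ν ≤_) (sym sum-μ) (ℕP.m≤n+m (sum ν) _)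
  m∈ : m ∈ choices (suc N) (sum (addRect (suc N) m ν) ∸ sum ν)
  m∈ = ∈-choices⁺ (s≤s z≤n) admissible
         (sym (trans (cong (_∸ sum ν) sum-μ) (ℕP.m+n∸n≡m (suc N * m) (sum ν))))

∈-altParts : ∀ N n {μ} → μ ∈ altParts N n ⇔ (AltPart N μ × sum μ ≡ n)
∈-altParts N n = mk⇔ (altParts-sound N n) λ where (μ-part , refl) → altParts-complete N μ-part

-- Distinct (ν, m) give distinct partitions, and ν determines its block i = sum ν.
altParts-unique : ∀ N n → Unique (altParts N n)
altParts-unique zero    zero    = [] ∷ []
altParts-unique zero    (suc n) = []
altParts-unique (suc N) n = map-unique (graft (suc N)) graft-injective
  (concatTo-unique n _
    (λ i → Unique.cartesianProduct⁺ (altParts-unique N i) (choices-unique (suc N) (n ∸ i)))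
    blocks-disjoint)
  where
  block : ℕ → List (List ℕ × ℕ)
  block i = cartesianProduct (altParts N i) (choices (suc N) (n ∸ i))
  blocks-disjoint : ∀ {i j p} → p ∈ block i → p ∈ block j → i ≡ j
  blocks-disjoint {i} {j} {ν , _} p∈i p∈j = trans
    (sym (proj₂ (altParts-sound N i (proj₁ (∈-cartesianProduct⁻ (altParts N i) _ p∈i)))))
    (proj₂ (altParts-sound N j (proj₁ (∈-cartesianProduct⁻ (altParts N j) _ p∈j))))
  graft-injective : ∀ {p q} → p ∈ graded (altParts N) (suc N) n → q ∈ graded (altParts N) (suc N) n →
    graft (suc N) p ≡ graft (suc N) q → p ≡ q
  graft-injective {ν , m} {ν' , m'} p∈ q∈ eq
    with ∈-graded⁻ (altParts N) (suc N) n p∈ | ∈-graded⁻ (altParts N) (suc N) n q∈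
  ... | i , _ , ν∈ , m∈ | i' , _ , ν'∈ , m'∈
    with refl , refl ← addRect-injective
                         (proj₁ (∈-choices⁻ (suc N) (n ∸ i) m∈)) (proj₁ (∈-choices⁻ (suc N) (n ∸ i') m'∈))
                         (proj₁ (altParts-sound N i ν∈)) (proj₁ (altParts-sound N i' ν'∈)) eq = refl

length≤sum : ∀ {μ} → All (0 <_) μ → length μ ≤ sum μ
length≤sum []          = z≤n
length≤sum (0<x ∷ μ>0) = ℕP.+-mono-≤ 0<x (length≤sum μ>0)

-- For N ≥ n the bound on the number of parts is automatic, so the count no longer depends on N.
altParts-stable : ∀ {N n} → n ≤ N → length (altParts N n) ≡ length (altParts n n)
altParts-stable {N} {n} n≤N =
  length-unique (altParts-unique N n) (altParts-unique n n) (mk⇔ drop-bound add-bound)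
  where
  drop-bound : ∀ {μ} → μ ∈ altParts N n → μ ∈ altParts n n
  drop-bound μ∈ with altParts-sound N n μ∈
  ... | (μ-alt , _) , refl = altParts-complete _ (μ-alt , length≤sum (alternating-above μ-alt))
  add-bound : ∀ {μ} → μ ∈ altParts n n → μ ∈ altParts N n
  add-bound μ∈ with altParts-sound n n μ∈
  ... | (μ-alt , μ≤n) , refl = altParts-complete N (μ-alt , ℕP.≤-trans μ≤n n≤N)

altParts-zero : ∀ N → length (altParts N 0) ≡ 1
altParts-zero N = length-unique (altParts-unique N 0) ([] ∷ [])
  (mk⇔ empty λ { (here refl) → altParts-complete N (nil , z≤n) })
  where
  empty : ∀ {μ} → μ ∈ altParts N 0 → μ ∈ [ [] ]
  empty {[]}    _  = here refl
  empty {x ∷ r} μ∈ with altParts-sound N 0 μ∈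
  ... | (μ-alt , _) , sum≡0 =
    contradiction (subst (length (x ∷ r) ≤_) sum≡0 (length≤sum (alternating-above μ-alt))) λ ()

drop-admissible : ∀ {x y} → y ≤ x → (x ≡ y ⊎ x % 2 ≢ y % 2) ⇔ Admissible (x ∸ y)
drop-admissible {x} {y} y≤x = mk⇔ to from
  where
  x≡y+drop : y ℕ.+ (x ∸ y) ≡ x
  x≡y+drop = ℕP.m+[n∸m]≡n y≤x
  to : x ≡ y ⊎ x % 2 ≢ y % 2 → Admissible (x ∸ y)
  to (inj₁ refl) = inj₁ (ℕP.n∸n≡0 x)
  to (inj₂ flips) =
    inj₂ (Equivalence.to (parity-flip y (x ∸ y)) (subst (λ z → z % 2 ≢ y % 2) (sym x≡y+drop) flips))
  from : Admissible (x ∸ y) → x ≡ y ⊎ x % 2 ≢ y % 2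
  from (inj₁ x∸y≡0) = inj₁ (ℕP.≤-antisym (ℕP.m∸n≡0⇒m≤n x∸y≡0) y≤x)
  from (inj₂ odd) =
    inj₂ (subst (λ z → z % 2 ≢ y % 2) x≡y+drop (Equivalence.from (parity-flip y (x ∸ y)) odd))

toAlternating : ∀ {p} → Linked _≥_ p → ParityAlternating p → SmallestPartOdd p → Alternating 0 p
toAlternating []  _ _ = nil
toAlternating [-] _ (_ , here refl , odd , _) = end z≤n odd
toAlternating {x ∷ y ∷ r} (y≤x ∷ decreasing) (alternates ∷ alternating) (m , m∈ , odd , m≤all) =
  cons y≤x (Equivalence.to (drop-admissible y≤x) alternates)
    (toAlternating decreasing alternating (m , in-tail m∈ m≤all , odd , All.tail m≤all))
  where
  in-tail : ∀ {m} → m ∈ x ∷ y ∷ r → All (m ≤_) (x ∷ y ∷ r) → m ∈ y ∷ r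
  in-tail (here refl) (_ ∷ m≤y ∷ _) = here (ℕP.≤-antisym m≤y y≤x)
  in-tail (there m∈) _ = m∈

fromAlternating : ∀ {b p} → Alternating b p → Linked _≥_ p × ParityAlternating p
fromAlternating nil = [] , []
fromAlternating (end _ _) = [-] , [-]
fromAlternating (cons y≤x admissible rest) with fromAlternating rest
... | decreasing , alternating =
  y≤x ∷ decreasing , Equivalence.from (drop-admissible y≤x) admissible ∷ alternating

smallest-odd : ∀ {x r} → Alternating 0 (x ∷ r) → SmallestPartOdd (x ∷ r)
smallest-odd (end _ odd) = _ , here refl , odd , ℕP.≤-refl ∷ []
smallest-odd (cons y≤x _ rest) with smallest-odd rest
... | m , m∈ , odd , m≤all@(m≤y ∷ _) = m , there m∈ , odd , ℕP.≤-trans m≤y y≤x ∷ m≤all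

IsPAo⇔altPart : ∀ {n p} → 1 ≤ n → IsPAo n p ⇔ (AltPart n p × sum p ≡ n)
IsPAo⇔altPart {n} {p} 1≤n = mk⇔ to from
  where
  to : IsPAo n p → AltPart n p × sum p ≡ n
  to ((decreasing , positive , sum≡n) , alternating , smallest) =
    (toAlternating decreasing alternating smallest , subst (length p ≤_) sum≡n (length≤sum positive)) ,
    sum≡n
  from : AltPart n p × sum p ≡ n → IsPAo n p
  from ((p-alt , _) , sum≡n) =
    (proj₁ (fromAlternating p-alt) , alternating-above p-alt , sum≡n) , proj₂ (fromAlternating p-alt) ,
    smallest p p-alt sum≡n
    where
    smallest : ∀ q → Alternating 0 q → sum q ≡ n → SmallestPartOdd q
    smallest []      _     sum≡n = contradiction (subst (1 ≤_) (sym sum≡n) 1≤n) λ ()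
    smallest (_ ∷ _) q-alt _     = smallest-odd q-alt

theorem4p4 : ((N : ℕ) → prodUpTo N 0 ≡ + 1)
    × ((n : ℕ) → 1 ≤ n → Σ (List (List ℕ)) λ L → Unique L
    × ((p : List ℕ) → (p ∈ L) ⇔ IsPAo n p)
    × ((N : ℕ) → n ≤ N → prodUpTo N n ≡ + length L))
theorem4p4 =
  (λ N → trans (prodUpTo-counts N 0) (cong +_ (altParts-zero N))) ,
  λ n 1≤n → altParts n n , altParts-unique n n ,
    (λ p → Equivalence-trans (∈-altParts n n) (⇔-sym (IsPAo⇔altPart 1≤n))) ,
    λ N n≤N → trans (prodUpTo-counts N n) (cong +_ (altParts-stable n≤N))
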